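{- Let $\Xi$ be a well-formed parametricity context. For all terms $M, M', N', M_R, N_R$ of $CC_\omega$, if $\Xi \vdash M \sim M' \text{ because } M_R$ and $\Xi \vdash M \sim N' \text{ because } N_R$, then $(M', M_R) = (N', N_R)$.
   Context: $CC_\omega$ terms: $A,B,M,N ::= \Box_i \mid x \mid M\,N \mid \lambda x : A.\,M \mid \Pi x : A.\,B$. A parametricity context is a list of triples of variables: $\Xi ::= \varepsilon \mid \Xi, (x, x', x_R)$. $\mathrm{Var}(\varepsilon)=\varepsilon$ and $\mathrm{Var}(\Xi,(x,x',x_R)) = \mathrm{Var}(\Xi), x, x', x_R$. $\Xi$ is well-formed ($\Xi \vdash$) if $\mathrm{Var}(\Xi)$ has no duplicates; then $\Xi(x) = (x', x_R)$ means $(x,x',x_R) \in \Xi$. The parametricity judgment $\Xi \vdash M \sim M' \text{ because } M_R$ is the relation inductively defined by the rules: (Sort) $\Xi \vdash \Box_i \sim \Box_i \text{ because } \lambda (A\,B : \Box_i).\, A \to B \to \Box_i$. (Var) if $(x,x',x_R) \in \Xi$ and $\Xi \vdash$, then $\Xi \vdash x \sim x' \text{ because } x_R$. (App) if $\Xi \vdash M \sim M' \text{ because } M_R$ and $\Xi \vdash N \sim N' \text{ because } N_R$, then $\Xi \vdash M\,N \sim M'\,N' \text{ because } M_R\,N\,N'\,N_R$. (Lam) if $\Xi \vdash A \sim A' \text{ because } A_R$ and $\Xi, (x,x',x_R) \vdash M \sim M' \text{ because } M_R$, then $\Xi \vdash \lambda x : A.\,M \sim \lambda x' : A'.\,M'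 \text{ because } \lambda x\,x'\,x_R.\,M_R$. (Pi) if $x, x' \notin \mathrm{Var}(\Xi)$, $\Xi \vdash A \sim A' \text{ because } A_R$ and $\Xi, (x,x',x_R) \vdash B \sim B' \text{ because } B_R$, then $\Xi \vdash \Pi x : A.\,B \sim \Pi x' : A'.\,B' \text{ because } \lambda f\,g.\,\Pi x\,x'\,x_R.\,B_R\,(f\,x)\,(g\,x')$. -}

module Defs where

open import Data.Nat using (ℕ)
open import Data.List using (List; []; _∷_; _++_)
open import Data.List.Membership.Propositional using (_∈_; _∉_)
open import Data.List.Relation.Unary.Unique.Propositional using (Unique)
open import Data.Product using (_×_; _,_)

-- Object variables are `nm k`; `x ′` and `x ᴿ` are the
-- canonical primed / relational companions of x used by the Lam and Pi rules
-- (a fixed naming convention, so that the translation is a function of its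
-- input, as in the parametricity plugin).  The remaining constructors are
-- the fixed names used for the binders that the translation itself introduces
-- (A, B in the Sort rule, f, g in the Pi rule, and the dummy binder of `→`).
infix 30 _′ _ᴿ
data Name : Set where
  nm   : ℕ → Name
  _′   : Name → Name
  _ᴿ   : Name → Name
  nA   : Name
  nB   : Name
  nf   : Name
  ng   : Name
  anon : Name

data Term : Set where
  □    : ℕ → Term
  var  : Name → Term
  app  : Term → Term → Term
  lam  : Name → Term → Term → Term   -- lam x A M  =  λ x : A. M
  pi   : Name → Term → Term → Term   -- pi x A B   =  Π x : A. B

_⇒_ : Term → Term → Term
A ⇒ B = pi anon A B
infixr 5 _⇒_


data PCtx : Set where
  ε    : PCtx
  _,,_ : PCtx → Name × Name × Name → PCtx

Vars : PCtx → List Name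
Vars ε = []
Vars (Ξ ,, (x , x' , xR)) = Vars Ξ ++ (x ∷ x' ∷ xR ∷ [])

WF : PCtx → Set
WF Ξ = Unique (Vars Ξ)

data _∋_ : PCtx → Name × Name × Name → Set where
  here  : ∀ {Ξ t} → (Ξ ,, t) ∋ t
  there : ∀ {Ξ t s} → Ξ ∋ t → (Ξ ,, s) ∋ t

data _⊢_~_because_ : PCtx → Term → Term → Term → Set where
  Sort : ∀ {Ξ i} →
    Ξ ⊢ □ i ~ □ i because lam nA (□ i) (lam nB (□ i) (var nA ⇒ var nB ⇒ □ i))
  Var : ∀ {Ξ x x' xR} → Ξ ∋ (x , x' , xR) → WF Ξ →
    Ξ ⊢ var x ~ var x' because var xR
  App : ∀ {Ξ M M' MR N N' NR} →
    Ξ ⊢ M ~ M' because MR → Ξ ⊢ N ~ N' because NR →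
    Ξ ⊢ app M N ~ app M' N' because app (app (app MR N) N') NR
  Lam : ∀ {Ξ A A' AR M M' MR x} → let x' = x ′ ; xR = x ᴿ in
    Ξ ⊢ A ~ A' because AR → (Ξ ,, (x , x' , xR)) ⊢ M ~ M' because MR →
    Ξ ⊢ lam x A M ~ lam x' A' M'
      because lam x A (lam x' A' (lam xR (app (app AR (var x)) (var x')) MR))
  Pi : ∀ {Ξ A A' AR B B' BR x} → let x' = x ′ ; xR = x ᴿ in
    x ∉ Vars Ξ → x' ∉ Vars Ξ →
    Ξ ⊢ A ~ A' because AR → (Ξ ,, (x , x' , xR)) ⊢ B ~ B' because BR →
    Ξ ⊢ pi x A B ~ pi x' A' B'
      because lam nf (pi x A B) (lam ng (pi x' A' B')
                (pi x A (pi x' A' (pi xR (app (app AR (var x)) (var x'))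
                   (app (app BR (app (var nf) (var x))) (app (var ng) (var x')))))))

{-# OPTIONS --safe #-}
module Submission where

open import Defs
open import Data.Empty using (⊥)
open import Data.List using (List; []; _∷_; _++_)
open import Data.List.Membership.Propositional using (_∈_)
open import Data.List.Membership.Propositional.Properties using (∈-++⁺ˡ; ∈-++⁺ʳ)
open import Data.List.Relation.Unary.All using (lookup)
open import Data.List.Relation.Unary.All.Properties using (++⁻ˡ; ++⁻ʳ)
open import Data.List.Relation.Unary.AllPairs using ([]; _∷_)
open import Data.List.Relation.Unary.Any using (here; there)
open import Data.List.Relation.Unary.Unique.Propositional using (Unique)
open import Data.Product using (_,_)
open import Relation.Binary.PropositionalEquality using (_≡_; refl)
open import Relation.Nullary using (contradiction)

private
  variable
    A : Set
    Ξ : PCtx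
    x a a' b b' : Name
    M M' N' MR NR : Term

Unique-++⁻ˡ : ∀ (xs : List A) {ys} → Unique (xs ++ ys) → Unique xs
Unique-++⁻ˡ []       _          = []
Unique-++⁻ˡ (x ∷ xs) (x∉ ∷ xs!) = ++⁻ˡ xs x∉ ∷ Unique-++⁻ˡ xs xs!

Unique-++-disjoint : ∀ (xs : List A) {ys z} → Unique (xs ++ ys) → z ∈ xs → z ∈ ys → ⊥
Unique-++-disjoint (x ∷ xs) (x∉ ∷ _)   (here refl) z∈ys = lookup (++⁻ʳ xs x∉) z∈ys refl
Unique-++-disjoint (x ∷ xs) (_ ∷ xs!) (there z∈xs) z∈ys = Unique-++-disjoint xs xs! z∈xs z∈ys

∋⇒∈-Vars : Ξ ∋ (x , a , b) → x ∈ Vars Ξ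
∋⇒∈-Vars {Ξ ,, _} here      = ∈-++⁺ʳ (Vars Ξ) (here refl)
∋⇒∈-Vars          (there p) = ∈-++⁺ˡ (∋⇒∈-Vars p)

∋-functional : WF Ξ → Ξ ∋ (x , a , b) → Ξ ∋ (x , a' , b') → (a , b) ≡ (a' , b')
∋-functional           _ here      here      = refl
∋-functional {Ξ ,, _} wf here      (there q) =
  contradiction (here refl) (Unique-++-disjoint (Vars Ξ) wf (∋⇒∈-Vars q))
∋-functional {Ξ ,, _} wf (there p) here      =
  contradiction (here refl) (Unique-++-disjoint (Vars Ξ) wf (∋⇒∈-Vars p))
∋-functional {Ξ ,, _} wf (there p) (there q) = ∋-functional (Unique-++⁻ˡ (Vars Ξ) wf) p q

-- Well-formedness is only needed at variables, where the Var rule itself provides it.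
~-functional : Ξ ⊢ M ~ M' because MR → Ξ ⊢ M ~ N' because NR → (M' , MR) ≡ (N' , NR)
~-functional Sort Sort = refl
~-functional (Var p wf) (Var q _) with ∋-functional wf p q
... | refl = refl
~-functional (App d e) (App d′ e′) with ~-functional d d′ | ~-functional e e′
... | refl | refl = refl
~-functional (Lam d e) (Lam d′ e′) with ~-functional d d′ | ~-functional e e′
... | refl | refl = refl
~-functional (Pi _ _ d e) (Pi _ _ d′ e′) with ~-functional d d′ | ~-functional e e′
... | refl | refl = refl

lemma5 : (Ξ : PCtx) → WF Ξ → (M M' N' MR NR : Term) →
         Ξ ⊢ M ~ M' because MR → Ξ ⊢ M ~ N' because NR →
         (M' , MR) ≡ (N' , NR)
lemma5 _ _ _ _ _ _ _ = ~-functional
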